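{- Let $G=(V,E)$ be a finite simple undirected graph with exactly $t$ isolated vertices. Let $M$ be a maximum matching of $G$, of size $m$, and let $k$ be the number of vertices $w\in V$ such that (i) $w$ is not an endpoint of any edge of $M$, and (ii) there is an edge $uv\in M$ with $w$ adjacent to both $u$ and $v$. Then every total cover of $G$ has at least $\frac{m+k}{2}+t$ elements; that is, $\alpha_2(G)\ge \frac{m+k}{2}+t$.
   Context: For a graph $G=(V,E)$, a vertex and an edge are adjacent/incident in the usual sense: two vertices are adjacent if joined by an edge, two edges are adjacent if they share an endpoint, and a vertex and an edge are incident if the vertex is an endpoint of the edge. A set $D\subseteq V\cup E$ is a total cover of $G$ if every element of $(V\cup E)\setminus D$ is adjacent or incident to some element of $D$. $\alpha_2(G)$ denotes the minimum size of a total cover of $G$. -}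

module Defs where

open import Data.Nat using (ℕ; _+_; _*_; _≤_)
open import Data.Bool using (Bool; true; false; T; _∧_; _∨_; not)
open import Data.Fin using (Fin; _<_)
open import Data.Fin.Properties using (_≟_)
open import Data.List using (List; length; filterᵇ; allFin)
open import Data.Bool.ListAction using (any; all)
open import Data.List.Relation.Unary.All using (All)
open import Data.List.Relation.Unary.Unique.Propositional using (Unique)
open import Data.List.Relation.Unary.AllPairs using (AllPairs)
open import Data.List.Membership.Propositional using (_∈_; _∉_)
open import Data.Product using (_×_; _,_; proj₁; proj₂; Σ; ∃)
open import Data.Sum using (_⊎_)
open import Data.Unit using (⊤)
open import Relation.Binary.PropositionalEquality using (_≡_; _≢_)
open import Relation.Nullary.Decidable using (⌊_⌋)

record Graph (n : ℕ) : Set where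
  field
    adj    : Fin n → Fin n → Bool
    sym    : ∀ u v → adj u v ≡ adj v u
    irrefl : ∀ v → adj v v ≡ false
open Graph public

_==_ : ∀ {n} → Fin n → Fin n → Bool
u == v = ⌊ u ≟ v ⌋

-- An edge {u,v} is represented canonically as the pair (u , v) with u < v.
IsEdge : ∀ {n} → Graph n → Fin n × Fin n → Set
IsEdge G (u , v) = u < v × T (adj G u v)

data Elem (n : ℕ) : Set where
  vtx  : Fin n → Elem n
  edge : Fin n → Fin n → Elem n

Valid : ∀ {n} → Graph n → Elem n → Set
Valid G (vtx v)    = ⊤
Valid G (edge u v) = IsEdge G (u , v)

_∈ₑ_ : ∀ {n} → Fin n → Fin n × Fin n → Set
w ∈ₑ (u , v) = w ≡ u ⊎ w ≡ v

Touches : ∀ {n} → Graph n → Elem n → Elem n → Set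
Touches G (vtx u)    (vtx v)    = T (adj G u v)
Touches G (vtx u)    (edge a b) = u ∈ₑ (a , b)
Touches G (edge a b) (vtx u)    = u ∈ₑ (a , b)
Touches G (edge a b) (edge c d) = a ∈ₑ (c , d) ⊎ b ∈ₑ (c , d)

record TotalCover {n} (G : Graph n) (D : List (Elem n)) : Set where
  field
    valid  : All (Valid G) D
    unique : Unique D
    covers : ∀ x → Valid G x → x ∉ D → ∃ λ y → y ∈ D × Touches G y x

Disjoint : ∀ {n} → Fin n × Fin n → Fin n × Fin n → Set
Disjoint (a , b) (c , d) = a ≢ c × a ≢ d × b ≢ c × b ≢ d

record IsMatching {n} (G : Graph n) (M : List (Fin n × Fin n)) : Set where
  field
    edges    : All (IsEdge G) M
    disjoint : AllPairs Disjoint M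

IsMaximumMatching : ∀ {n} → Graph n → List (Fin n × Fin n) → Set
IsMaximumMatching G M =
  IsMatching G M × (∀ M' → IsMatching G M' → length M' ≤ length M)

countV : ∀ {n} → (Fin n → Bool) → ℕ
countV {n} p = length (filterᵇ p (allFin n))

isolated : ∀ {n} → Graph n → Fin n → Bool
isolated {n} G w = all (λ u → not (adj G w u)) (allFin n)

isolatedCount : ∀ {n} → Graph n → ℕ
isolatedCount G = countV (isolated G)

coveredBy : ∀ {n} → List (Fin n × Fin n) → Fin n → Bool
coveredBy M w = any (λ e → (w == proj₁ e) ∨ (w == proj₂ e)) M

kVertex : ∀ {n} → Graph n → List (Fin n × Fin n) → Fin n → Bool
kVertex G M w =
  not (coveredBy M w) ∧ any (λ e → adj G w (proj₁ e) ∧ adj G w (proj₂ e)) M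

kCount : ∀ {n} → Graph n → List (Fin n × Fin n) → ℕ
kCount G M = countV (kVertex G M)

module Submission where

-- The proof passes through a vertex cover S of G (a set of vertices meeting
-- every edge) and consists of two injections.
--
--  * From D to S.  The shadow S of D consists of the non-isolated vertices
--    of D together with the endpoints of the edges of D; it is a vertex
--    cover.  Every element of D offers two slots, and the slots absorb the
--    vertices of S (a vertex takes its own slot, an edge hands one slot to
--    each endpoint) as well as two copies of every isolated vertex, which
--    must itself lie in D.  Hence |S| + 2t ≤ 2|D|.
--
--  * From S to M.  For any vertex cover S, choose an endpoint in S for each
--    edge of M, and for each counted vertex w, lying over the edge uv ∈ M,
--    choose v if u, v ∈ S and w otherwise (then w ∈ S).  Maximality of M
--    (no augmenting path w-u-v-w') makes this choice injective, so m + k ≤ |S|.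

open import Defs renaming (sym to adj-symmetric)
open import Data.Nat using (ℕ; suc; _+_; _*_; _≤_; z≤n; s≤s)
open import Data.Nat.Properties
  using (≤-trans; ≤-reflexive; +-suc; *-suc; +-monoˡ-≤; 1+n≰n; module ≤-Reasoning)
open import Data.Bool using (Bool; true; false; T; _∧_; _∨_; not; if_then_else_)
open import Data.Bool.Properties using (T?)
open import Data.Bool.ListAction using (any)
open import Data.Unit using (tt)
open import Data.Empty using (⊥; ⊥-elim)
open import Data.Product using (_×_; _,_; proj₁; proj₂)
open import Data.Sum using (_⊎_; inj₁; inj₂; [_,_])
open import Data.Sum.Properties using (inj₁-injective; inj₂-injective)
open import Data.Fin using (Fin)
open import Data.Fin.Properties using (_≟_; <-cmp)
open import Data.List using (List; []; _∷_; length; map; _++_; allFin; filterᵇ)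
open import Data.List.Properties using (length-++; length-map)
open import Data.List.Relation.Unary.All as All using (All; []; _∷_)
import Data.List.Relation.Unary.All.Properties as AllProps
open import Data.List.Relation.Unary.Any using (here; there)
open import Data.List.Relation.Unary.Any.Properties using (any⁺; any⁻)
open import Data.List.Relation.Unary.AllPairs as AllPairs using (AllPairs; []; _∷_)
open import Data.List.Relation.Unary.Unique.Propositional using (Unique)
import Data.List.Relation.Unary.Unique.Propositional.Properties as UniqueProps
open import Data.List.Membership.Propositional using (_∈_; find; lose)
open import Data.List.Membership.Propositional.Properties
  using (∈-∃++; ∈-++⁻; ∈-++⁺ˡ; ∈-++⁺ʳ; ∈-map⁻; ∈-allFin; ∈-filter⁺)
open import Relation.Binary.PropositionalEquality
  using (_≡_; _≢_; refl; sym; trans; cong; subst; module ≡-Reasoning)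
open import Relation.Binary.Definitions using (tri<; tri≈; tri>)
open import Relation.Nullary using (Dec; yes; no; ¬_)
open import Relation.Nullary.Decidable using (⌊_⌋)
open import Function using (_∘_)

-- Reflection between Booleans and propositions (a Boolean argument is
-- explicit where Agda cannot infer it from the type T (…)).

∧-elimˡ : ∀ {a b} → T (a ∧ b) → T a
∧-elimˡ {true} _ = tt

∧-elimʳ : ∀ a {b} → T (a ∧ b) → T b
∧-elimʳ true t = t

∨-elim : ∀ a {b} → T (a ∨ b) → T a ⊎ T b
∨-elim true  t = inj₁ tt
∨-elim false t = inj₂ t

∨-introˡ : ∀ {a b} → T a → T (a ∨ b)
∨-introˡ {true} _ = tt

∨-introʳ : ∀ a {b} → T b → T (a ∨ b)
∨-introʳ true  _ = tt
∨-introʳ false t = t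

not-elim : ∀ {b} → T (not b) → ¬ T b
not-elim {false} _ ()

not-intro : ∀ {b} → ¬ T b → T (not b)
not-intro {true}  f = f tt
not-intro {false} _ = tt

T-true : ∀ {b} → b ≡ true → T b
T-true refl = tt

¬T-false : ∀ {b} → b ≡ false → ¬ T b
¬T-false refl ()

==-refl : ∀ {n} (x : Fin n) → T (x == x)
==-refl x with x ≟ x
... | yes _  = tt
... | no x≢x = x≢x refl

==-sound : ∀ {n} {x y : Fin n} → T (x == y) → x ≡ y
==-sound {x = x} {y} t with x ≟ y
... | yes x≡y = x≡y

-- Counting by injections into lists

unique-⊆-length : ∀ {A : Set} {xs ys : List A} →
                  Unique xs → All (_∈ ys) xs → length xs ≤ length ys
unique-⊆-length [] [] = z≤n
unique-⊆-length {xs = x ∷ xs} (x∉xs ∷ uxs) (x∈ys ∷ xs⊆ys) with ∈-∃++ x∈ys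
... | ys₁ , ys₂ , refl = ≤-trans (s≤s (unique-⊆-length uxs (All.zipWith drop (x∉xs , xs⊆ys))))
                                  (≤-reflexive (sym length-middle))
  where
  drop : ∀ {y} → x ≢ y × y ∈ ys₁ ++ x ∷ ys₂ → y ∈ ys₁ ++ ys₂
  drop (x≢y , y∈) with ∈-++⁻ ys₁ y∈
  ... | inj₁ y∈ys₁         = ∈-++⁺ˡ y∈ys₁
  ... | inj₂ (here y≡x)    = ⊥-elim (x≢y (sym y≡x))
  ... | inj₂ (there y∈ys₂) = ∈-++⁺ʳ ys₁ y∈ys₂

  length-middle : length (ys₁ ++ x ∷ ys₂) ≡ suc (length (ys₁ ++ ys₂))
  length-middle = begin
    length (ys₁ ++ x ∷ ys₂)          ≡⟨ length-++ ys₁ ⟩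
    length ys₁ + suc (length ys₂)    ≡⟨ +-suc (length ys₁) (length ys₂) ⟩
    suc (length ys₁ + length ys₂)    ≡⟨ cong suc (sym (length-++ ys₁)) ⟩
    suc (length (ys₁ ++ ys₂))        ∎
    where open ≡-Reasoning

unique-map : ∀ {A B : Set} (P : A → Set) (f : A → B) {xs : List A} →
             (∀ {x y} → P x → P y → f x ≡ f y → x ≡ y) →
             All P xs → Unique xs → Unique (map f xs)
unique-map P f f-inj [] [] = []
unique-map P f f-inj (px ∷ pxs) (x∉xs ∷ uxs) =
  apart pxs x∉xs ∷ unique-map P f f-inj pxs uxs
  where
  apart : ∀ {ys} → All P ys → All (_ ≢_) ys → All (f _ ≢_) (map f ys)
  apart [] [] = []
  apart (py ∷ pys) (x≢y ∷ x≢ys) = (λ fx≡fy → x≢y (f-inj px py fx≡fy)) ∷ apart pys x≢ys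

injection-bound : ∀ {A B : Set} (P : A → Set) (f : A → B) {xs : List A} {ys : List B} →
                  Unique xs → All P xs →
                  (∀ {x y} → P x → P y → f x ≡ f y → x ≡ y) →
                  (∀ {x} → P x → f x ∈ ys) →
                  length xs ≤ length ys
injection-bound P f {xs} uxs pxs f-inj f-into =
  subst (_≤ _) (length-map f xs)
        (unique-⊆-length (unique-map P f f-inj pxs uxs) (AllProps.map⁺ (All.map f-into pxs)))

tagged : ∀ {A : Set} → List A → List (A × Bool)
tagged []       = []
tagged (x ∷ xs) = (x , false) ∷ (x , true) ∷ tagged xs

length-tagged : ∀ {A : Set} (xs : List A) → length (tagged xs) ≡ 2 * length xs
length-tagged []       = refl
length-tagged (x ∷ xs) = trans (cong (suc ∘ suc) (length-tagged xs)) (sym (*-suc 2 (length xs)))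

tagged-∈ : ∀ {A : Set} {x : A} {xs} b → x ∈ xs → (x , b) ∈ tagged xs
tagged-∈ false (here refl) = here refl
tagged-∈ true  (here refl) = there (here refl)
tagged-∈ b     (there x∈xs) = there (there (tagged-∈ b x∈xs))

tagged-all : ∀ {A : Set} {P : A → Set} {xs} → All P xs → All (P ∘ proj₁) (tagged xs)
tagged-all []         = []
tagged-all (px ∷ pxs) = px ∷ px ∷ tagged-all pxs

tagged-unique : ∀ {A : Set} {xs : List A} → Unique xs → Unique (tagged xs)
tagged-unique {xs = []} [] = []
tagged-unique {xs = x ∷ xs} (x∉xs ∷ uxs) =
  ((λ ()) ∷ fresh x∉xs) ∷ fresh x∉xs ∷ tagged-unique uxs
  where
  fresh : ∀ {b ys} → All (x ≢_) ys → All ((x , b) ≢_) (tagged ys)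
  fresh []            = []
  fresh (x≢y ∷ x≢ys) = (x≢y ∘ cong proj₁) ∷ (x≢y ∘ cong proj₁) ∷ fresh x≢ys

_⊕_ : ∀ {A B : Set} → List A → List B → List (A ⊎ B)
xs ⊕ ys = map inj₁ xs ++ map inj₂ ys

length-⊕ : ∀ {A B : Set} (xs : List A) (ys : List B) →
           length (xs ⊕ ys) ≡ length xs + length ys
length-⊕ xs ys = begin
  length (map inj₁ xs ++ map inj₂ ys)          ≡⟨ length-++ (map inj₁ xs) ⟩
  length (map inj₁ xs) + length (map inj₂ ys)  ≡⟨ cong (_+ _) (length-map inj₁ xs) ⟩
  length xs + length (map inj₂ ys)             ≡⟨ cong (length xs +_) (length-map inj₂ ys) ⟩
  length xs + length ys                        ∎
  where open ≡-Reasoning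

⊕-all : ∀ {A B : Set} {P : A → Set} {Q : B → Set} {xs ys} →
        All P xs → All Q ys → All [ P , Q ] (xs ⊕ ys)
⊕-all pxs qys = AllProps.++⁺ (AllProps.map⁺ pxs) (AllProps.map⁺ qys)

⊕-unique : ∀ {A B : Set} {xs : List A} {ys : List B} →
           Unique xs → Unique ys → Unique (xs ⊕ ys)
⊕-unique {xs = xs} {ys} uxs uys = UniqueProps.++⁺ (UniqueProps.map⁺ inj₁-injective uxs)
                                   (UniqueProps.map⁺ inj₂-injective uys) sides
  where
  sides : ∀ {v} → ¬ (v ∈ map inj₁ xs × v ∈ map inj₂ ys)
  sides (v∈₁ , v∈₂) with ∈-map⁻ inj₁ v∈₁ | ∈-map⁻ inj₂ v∈₂
  ... | _ , _ , refl | _ , _ , ()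

vertices : ∀ {n} → (Fin n → Bool) → List (Fin n)
vertices {n} p = filterᵇ p (allFin n)

vertices-unique : ∀ {n} (p : Fin n → Bool) → Unique (vertices p)
vertices-unique {n} p = UniqueProps.filter⁺ (T? ∘ p) (UniqueProps.allFin⁺ n)

vertices-sound : ∀ {n} (p : Fin n → Bool) → All (T ∘ p) (vertices p)
vertices-sound {n} p = AllProps.all-filter (T? ∘ p) (allFin n)

vertices-complete : ∀ {n} (p : Fin n → Bool) {x} → T (p x) → x ∈ vertices p
vertices-complete p {x} px = ∈-filter⁺ (T? ∘ p) (∈-allFin x) px

Pair : ℕ → Set
Pair n = Fin n × Fin n

module _ {n : ℕ} (G : Graph n) where

  adj-sym : ∀ {a b} → T (adj G a b) → T (adj G b a)
  adj-sym {a} {b} = subst T (adj-symmetric G a b)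

  adj-≢ : ∀ {a b} → T (adj G a b) → a ≢ b
  adj-≢ {a} ab refl = subst T (irrefl G a) ab

  orient : Fin n → Fin n → Pair n
  orient a b with <-cmp a b
  ... | tri< _ _ _ = a , b
  ... | tri≈ _ _ _ = a , b
  ... | tri> _ _ _ = b , a

  orient-isEdge : ∀ {a b} → T (adj G a b) → IsEdge G (orient a b)
  orient-isEdge {a} {b} ab with <-cmp a b
  ... | tri< a<b _ _ = a<b , ab
  ... | tri≈ _ a≡b _ = ⊥-elim (adj-≢ ab a≡b)
  ... | tri> _ _ b<a = b<a , adj-sym ab

  orient-endpoints : ∀ {a b x} → x ∈ₑ orient a b → x ∈ₑ (a , b)
  orient-endpoints {a} {b} x∈ with <-cmp a b
  ... | tri< _ _ _ = x∈
  ... | tri≈ _ _ _ = x∈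
  ... | tri> _ _ _ with x∈
  ...   | inj₁ x≡b = inj₂ x≡b
  ...   | inj₂ x≡a = inj₁ x≡a

  isolated-no-neighbour : ∀ {x u} → T (isolated G x) → ¬ T (adj G x u)
  isolated-no-neighbour {x} {u} iso =
    not-elim (All.lookup (AllProps.all⁺ (λ u → not (adj G x u)) (allFin n) iso) (∈-allFin u))

  endpoint-nonisolated : ∀ {x e} → IsEdge G e → x ∈ₑ e → ¬ T (isolated G x)
  endpoint-nonisolated (_ , ab) (inj₁ refl) iso = isolated-no-neighbour iso ab
  endpoint-nonisolated (_ , ab) (inj₂ refl) iso = isolated-no-neighbour iso (adj-sym ab)

  isolated-untouched : ∀ {x} y → T (isolated G x) → Valid G y → ¬ Touches G y (vtx x)
  isolated-untouched (vtx u)    iso _      ux    = isolated-no-neighbour iso (adj-sym ux)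
  isolated-untouched (edge a b) iso ab-edge x∈ab = endpoint-nonisolated ab-edge x∈ab iso

IsVertexCover : ∀ {n} → Graph n → (Fin n → Bool) → Set
IsVertexCover {n} G s = ∀ (a b : Fin n) → T (adj G a b) → T (s a) ⊎ T (s b)

meets-endpoint : ∀ {n} (s : Fin n → Bool) {a b x : Fin n} → x ∈ₑ (a , b) → T (s x) → T (s a) ⊎ T (s b)
meets-endpoint s (inj₁ refl) = inj₁
meets-endpoint s (inj₂ refl) = inj₂

vertexCover-from-edges : ∀ {n} (G : Graph n) (s : Fin n → Bool) →
  (∀ {e} → IsEdge G e → T (s (proj₁ e)) ⊎ T (s (proj₂ e))) → IsVertexCover G s
vertexCover-from-edges G s meets a b ab with meets (orient-isEdge G ab)
... | inj₁ s₁ = meets-endpoint s (orient-endpoints G (inj₁ refl)) s₁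
... | inj₂ s₂ = meets-endpoint s (orient-endpoints G (inj₂ refl)) s₂

-- Matchings

Apart : ∀ {n} → Pair n → Pair n → Set
Apart e f = ∀ x → x ∈ₑ e → ¬ x ∈ₑ f

Disjoint⇒Apart : ∀ {n} {e f : Pair n} → Disjoint e f → Apart e f
Disjoint⇒Apart (a≢c , a≢d , b≢c , b≢d) x (inj₁ refl) (inj₁ refl) = a≢c refl
Disjoint⇒Apart (a≢c , a≢d , b≢c , b≢d) x (inj₁ refl) (inj₂ refl) = a≢d refl
Disjoint⇒Apart (a≢c , a≢d , b≢c , b≢d) x (inj₂ refl) (inj₁ refl) = b≢c refl
Disjoint⇒Apart (a≢c , a≢d , b≢c , b≢d) x (inj₂ refl) (inj₂ refl) = b≢d refl

Apart⇒Disjoint : ∀ {n} {e f : Pair n} → Apart e f → Disjoint e f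
Apart⇒Disjoint {e = a , b} apart =
  (apart a (inj₁ refl) ∘ inj₁) , (apart a (inj₁ refl) ∘ inj₂) ,
  (apart b (inj₂ refl) ∘ inj₁) , (apart b (inj₂ refl) ∘ inj₂)

matching-unique : ∀ {n} {xs : List (Pair n)} → AllPairs Disjoint xs → Unique xs
matching-unique = AllPairs.map (λ { (a≢a , _) refl → a≢a refl })

shared-vertex-same-edge : ∀ {n} {xs : List (Pair n)} → AllPairs Disjoint xs →
  ∀ {e f x} → e ∈ xs → f ∈ xs → x ∈ₑ e → x ∈ₑ f → e ≡ f
shared-vertex-same-edge (_ ∷ _)   (here refl) (here refl) _ _ = refl
shared-vertex-same-edge (e# ∷ _)  (here refl) (there f∈) x∈e x∈f =
  ⊥-elim (Disjoint⇒Apart (All.lookup e# f∈) _ x∈e x∈f)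
shared-vertex-same-edge (f# ∷ _)  (there e∈) (here refl) x∈e x∈f =
  ⊥-elim (Disjoint⇒Apart (All.lookup f# e∈) _ x∈f x∈e)
shared-vertex-same-edge (_ ∷ xs#) (there e∈) (there f∈) x∈e x∈f =
  shared-vertex-same-edge xs# e∈ f∈ x∈e x∈f

record Removal {n} (xs : List (Pair n)) (e : Pair n) : Set where
  field
    rest          : List (Pair n)
    length-rest   : length xs ≡ suc (length rest)
    rest-disjoint : AllPairs Disjoint rest
    ⊆-xs          : ∀ {f} → f ∈ rest → f ∈ xs
    apart         : ∀ {f} → f ∈ rest → Apart e f

remove : ∀ {n} {xs : List (Pair n)} {e} → e ∈ xs → AllPairs Disjoint xs → Removal xs e
remove (here refl) (e# ∷ xs#) = record
  { rest = _ ; length-rest = refl ; rest-disjoint = xs#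
  ; ⊆-xs = there ; apart = λ f∈ → Disjoint⇒Apart (All.lookup e# f∈) }
remove {xs = g ∷ xs} {e} (there e∈) (g# ∷ xs#) = record
  { rest          = g ∷ rest
  ; length-rest   = cong suc length-rest
  ; rest-disjoint = All.tabulate (λ f∈ → All.lookup g# (⊆-xs f∈)) ∷ rest-disjoint
  ; ⊆-xs          = λ { (here refl) → here refl ; (there f∈) → there (⊆-xs f∈) }
  ; apart         = λ { (here refl) x x∈e x∈g → Disjoint⇒Apart (All.lookup g# e∈) x x∈g x∈e
                      ; (there f∈) → apart f∈ }
  }
  where open Removal (remove e∈ xs#)

matched : ∀ {n} {M : List (Pair n)} {e x} → e ∈ M → x ∈ₑ e → T (coveredBy M x)
matched {M = M} {x = x} e∈M x∈e = any⁺ _ (lose e∈M (hit x∈e))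
  where
  hit : ∀ {e} → x ∈ₑ e → T ((x == proj₁ e) ∨ (x == proj₂ e))
  hit (inj₁ refl) = ∨-introˡ (==-refl x)
  hit (inj₂ refl) = ∨-introʳ (x == _) (==-refl x)

Unmatched : ∀ {n} → List (Pair n) → Fin n → Set
Unmatched M w = T (not (coveredBy M w))

unmatched-apart : ∀ {n} {M : List (Pair n)} {w e} → Unmatched M w → e ∈ M → ¬ w ∈ₑ e
unmatched-apart w-free e∈M w∈e = not-elim w-free (matched e∈M w∈e)

module _ {n : ℕ} {G : Graph n} {M : List (Pair n)} (maximum : IsMaximumMatching G M) where
  open IsMatching (proj₁ maximum)

  -- Berge's condition, in the case of a path of length three: two distinct
  -- unmatched vertices w₁, w₂ with w₁ ~ u and w₂ ~ v for uv ∈ M would give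
  -- the larger matching (M - uv) + w₁u + w₂v.
  no-augmenting-path : ∀ {u v w₁ w₂} → (u , v) ∈ M → w₁ ≢ w₂ →
    Unmatched M w₁ → Unmatched M w₂ → T (adj G w₁ u) → T (adj G w₂ v) → ⊥
  no-augmenting-path {u} {v} {w₁} {w₂} uv∈M w₁≢w₂ w₁-free w₂-free w₁u w₂v =
    1+n≰n (subst (suc (suc (length rest)) ≤_) length-rest (proj₂ maximum augmented augmented-matching))
    where
    open Removal (remove uv∈M disjoint)
    e₁ e₂ : Pair n
    e₁ = orient G w₁ u
    e₂ = orient G w₂ v

    augmented : List (Pair n)
    augmented = e₁ ∷ e₂ ∷ rest

    free-or-u : ∀ {x} → x ∈ₑ e₁ → x ≡ w₁ ⊎ x ≡ u
    free-or-u = orient-endpoints G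
    free-or-v : ∀ {x} → x ∈ₑ e₂ → x ≡ w₂ ⊎ x ≡ v
    free-or-v = orient-endpoints G

    e₁-e₂ : Apart e₁ e₂
    e₁-e₂ x x∈e₁ x∈e₂ with free-or-u x∈e₁ | free-or-v x∈e₂
    ... | inj₁ refl | inj₁ refl = w₁≢w₂ refl
    ... | inj₁ refl | inj₂ refl = unmatched-apart w₁-free uv∈M (inj₂ refl)
    ... | inj₂ refl | inj₁ refl = unmatched-apart w₂-free uv∈M (inj₁ refl)
    ... | inj₂ refl | inj₂ refl = adj-≢ G (proj₂ (All.lookup edges uv∈M)) refl

    e₁-rest : ∀ {f} → f ∈ rest → Apart e₁ f
    e₁-rest f∈ x x∈e₁ x∈f with free-or-u x∈e₁
    ... | inj₁ refl = unmatched-apart w₁-free (⊆-xs f∈) x∈f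
    ... | inj₂ refl = apart f∈ x (inj₁ refl) x∈f

    e₂-rest : ∀ {f} → f ∈ rest → Apart e₂ f
    e₂-rest f∈ x x∈e₂ x∈f with free-or-v x∈e₂
    ... | inj₁ refl = unmatched-apart w₂-free (⊆-xs f∈) x∈f
    ... | inj₂ refl = apart f∈ x (inj₂ refl) x∈f

    augmented-matching : IsMatching G augmented
    augmented-matching = record
      { edges    = orient-isEdge G w₁u ∷ orient-isEdge G w₂v
                   ∷ All.tabulate (All.lookup edges ∘ ⊆-xs)
      ; disjoint = (Apart⇒Disjoint e₁-e₂ ∷ All.tabulate (Apart⇒Disjoint ∘ e₁-rest))
                   ∷ All.tabulate (Apart⇒Disjoint ∘ e₂-rest) ∷ rest-disjoint
      }

-- First bound: a maximum matching against an arbitrary vertex cover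

module MatchingBound {n : ℕ} {G : Graph n} {M : List (Pair n)} (maximum : IsMaximumMatching G M)
                     (s : Fin n → Bool) (cover : IsVertexCover G s) where
  open IsMatching (proj₁ maximum)

  Counted : Fin n → Set
  Counted w = T (kVertex G M w)

  pick : Pair n → Fin n
  pick (u , v) = if s u then u else v

  pick-endpoint : ∀ e → pick e ∈ₑ e
  pick-endpoint (u , v) with s u
  ... | true  = inj₁ refl
  ... | false = inj₂ refl

  pick-cover : ∀ {e} → e ∈ M → T (s (pick e))
  pick-cover {u , v} e∈M with s u in su | cover u v (proj₂ (All.lookup edges e∈M))
  ... | true  | _       = T-true su
  ... | false | inj₁ ()
  ... | false | inj₂ sv  = sv

  pick-first : ∀ {u v} → T (s u) → pick (u , v) ≡ u
  pick-first {u} su with s u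
  ... | true = refl

  bothAdjacent : Fin n → Pair n → Bool
  bothAdjacent w e = adj G w (proj₁ e) ∧ adj G w (proj₂ e)

  -- The first edge of es whose both endpoints are neighbours of w (a dummy
  -- pair if there is none).
  partner : Fin n → List (Pair n) → Pair n
  partner w []       = w , w
  partner w (e ∷ es) = if bothAdjacent w e then e else partner w es

  partner-spec : ∀ w es → T (any (bothAdjacent w) es) →
                 partner w es ∈ es × T (bothAdjacent w (partner w es))
  partner-spec w (e ∷ es) t with bothAdjacent w e in we
  ... | true  = here refl , T-true we
  ... | false with partner-spec w es t
  ...   | p∈es , wp = there p∈es , wp

  represent : Fin n → Fin n
  represent w = if s (proj₁ (partner w M)) ∧ s (proj₂ (partner w M)) then proj₂ (partner w M) else w

  data Representative (w : Fin n) : Fin n → Set where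
    viaEdge : ∀ {u v} → (u , v) ∈ M → T (adj G w u) → T (adj G w v) →
              T (s u) → T (s v) → Representative w v
    itself  : T (s w) → Representative w w

  other-end : ∀ {a b} → T (adj G a b) → ¬ T (s b) → T (s a)
  other-end {a} {b} ab ¬sb with cover a b ab
  ... | inj₁ sa = sa
  ... | inj₂ sb = ⊥-elim (¬sb sb)

  representative : ∀ {w} → Counted w → Representative w (represent w)
  representative {w} counted with partner-spec w M (∧-elimʳ (not (coveredBy M w)) counted)
  ... | e∈M , wuv with s (proj₁ (partner w M)) in su | s (proj₂ (partner w M)) in sv
  ...   | true  | true  = viaEdge e∈M (∧-elimˡ wuv) (∧-elimʳ _ wuv) (T-true su) (T-true sv)
  ...   | true  | false = itself (other-end (∧-elimʳ _ wuv) (¬T-false sv))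
  ...   | false | _     = itself (other-end (∧-elimˡ wuv) (¬T-false su))

  counted-unmatched : ∀ {w} → Counted w → Unmatched M w
  counted-unmatched = ∧-elimˡ

  representative-cover : ∀ {w r} → Representative w r → T (s r)
  representative-cover (viaEdge _ _ _ _ sv) = sv
  representative-cover (itself sw)          = sw

  pick-injective : ∀ {e f} → e ∈ M → f ∈ M → pick e ≡ pick f → e ≡ f
  pick-injective {e} {f} e∈M f∈M same =
    shared-vertex-same-edge disjoint e∈M f∈M (pick-endpoint e) (subst (_∈ₑ f) (sym same) (pick-endpoint f))

  -- The cover vertex picked on an edge of M is never a representative: it is
  -- matched, and it is the first end of its edge when both ends are in S.
  pick≢representative : ∀ {e w r} → e ∈ M → Counted w → Representative w r → pick e ≢ r
  pick≢representative {e} e∈M counted (itself _) same =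
    unmatched-apart (counted-unmatched counted) e∈M (subst (_∈ₑ e) same (pick-endpoint e))
  pick≢representative {e} e∈M counted (viaEdge uv∈M _ _ su _) same
    with shared-vertex-same-edge disjoint e∈M uv∈M (pick-endpoint e) (inj₂ same)
  ... | refl = adj-≢ G (proj₂ (All.lookup edges uv∈M)) (trans (sym (pick-first su)) same)

  -- Distinct counted vertices have distinct representatives; two vertices
  -- over the same edge would form an augmenting path.
  same-representative : ∀ {w₁ w₂ r} → Counted w₁ → Counted w₂ →
                        Representative w₁ r → Representative w₂ r → w₁ ≡ w₂
  same-representative {w₁} {w₂} c₁ c₂ r₁ r₂ with w₁ ≟ w₂
  ... | yes w₁≡w₂ = w₁≡w₂
  ... | no w₁≢w₂ with r₁ | r₂
  ...   | itself _ | itself _ = refl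
  ...   | itself _ | viaEdge uv∈M _ _ _ _ =
            ⊥-elim (unmatched-apart (counted-unmatched c₁) uv∈M (inj₂ refl))
  ...   | viaEdge uv∈M _ _ _ _ | itself _ =
            ⊥-elim (unmatched-apart (counted-unmatched c₂) uv∈M (inj₂ refl))
  ...   | viaEdge uv∈M w₁u _ _ _ | viaEdge uv∈M′ _ w₂v _ _
      with shared-vertex-same-edge disjoint uv∈M uv∈M′ (inj₂ refl) (inj₂ refl)
  ...     | refl = ⊥-elim (no-augmenting-path maximum uv∈M w₁≢w₂
                             (counted-unmatched c₁) (counted-unmatched c₂) w₁u w₂v)

  Source : Set
  Source = Pair n ⊎ Fin n

  Relevant : Source → Set
  Relevant = [ _∈ M , Counted ]

  image : Source → Fin n
  image (inj₁ e) = pick e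
  image (inj₂ w) = represent w

  image-injective : ∀ {p q} → Relevant p → Relevant q → image p ≡ image q → p ≡ q
  image-injective {inj₁ e} {inj₁ f} e∈M f∈M same = cong inj₁ (pick-injective e∈M f∈M same)
  image-injective {inj₁ e} {inj₂ w} e∈M cw same  =
    ⊥-elim (pick≢representative e∈M cw (representative cw) same)
  image-injective {inj₂ w} {inj₁ e} cw e∈M same  =
    ⊥-elim (pick≢representative e∈M cw (representative cw) (sym same))
  image-injective {inj₂ v} {inj₂ w} cv cw same   =
    cong inj₂ (same-representative cv cw (representative cv)
                 (subst (Representative w) (sym same) (representative cw)))

  image-cover : ∀ {p} → Relevant p → image p ∈ vertices s
  image-cover {inj₁ e} e∈M = vertices-complete s (pick-cover e∈M)
  image-cover {inj₂ w} cw  = vertices-complete s (representative-cover (representative cw))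

  matching-bound : length M + kCount G M ≤ countV s
  matching-bound = subst (_≤ countV s) (length-⊕ M (vertices (kVertex G M)))
    (injection-bound Relevant image
      (⊕-unique (matching-unique disjoint) (vertices-unique (kVertex G M)))
      (⊕-all (All.tabulate (λ e∈M → e∈M)) (vertices-sound (kVertex G M)))
      image-injective (λ {p} → image-cover {p}))

-- Second bound: the shadow of a total cover

_≟ᴱ_ : ∀ {n} (x y : Elem n) → Dec (x ≡ y)
vtx a ≟ᴱ vtx b with a ≟ b
... | yes refl = yes refl
... | no a≢b   = no λ { refl → a≢b refl }
vtx _ ≟ᴱ edge _ _ = no λ ()
edge _ _ ≟ᴱ vtx _ = no λ ()
edge a b ≟ᴱ edge c d with a ≟ c | b ≟ d
... | yes refl | yes refl = yes refl
... | no a≢c   | _        = no λ { refl → a≢c refl }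
... | yes _    | no b≢d   = no λ { refl → b≢d refl }

module ShadowBound {n : ℕ} (G : Graph n) {D : List (Elem n)} (total : TotalCover G D) where
  open TotalCover total
  open import Data.List.Membership.DecPropositional (_≟ᴱ_ {n}) using (_∈?_)

  hasEndpoint : Fin n → Elem n → Bool
  hasEndpoint x (vtx _)    = false
  hasEndpoint x (edge a b) = (x == a) ∨ (x == b)

  shadow : Fin n → Bool
  shadow x = (⌊ vtx x ∈? D ⌋ ∧ not (isolated G x)) ∨ any (hasEndpoint x) D

  endpoint-shadow : ∀ {a b x} → edge a b ∈ D → x ∈ₑ (a , b) → T (shadow x)
  endpoint-shadow {a} {b} {x} ab∈D x∈ab =
    ∨-introʳ (⌊ vtx x ∈? D ⌋ ∧ not (isolated G x)) (any⁺ (hasEndpoint x) (lose ab∈D (hit x∈ab)))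
    where
    hit : x ∈ₑ (a , b) → T (hasEndpoint x (edge a b))
    hit (inj₁ refl) = ∨-introˡ (==-refl x)
    hit (inj₂ refl) = ∨-introʳ (x == a) (==-refl x)

  vertex-shadow : ∀ {x u} → vtx x ∈ D → T (adj G x u) → T (shadow x)
  vertex-shadow {x} x∈D xu with vtx x ∈? D
  ... | yes _   = ∨-introˡ (not-intro (λ iso → isolated-no-neighbour G iso xu))
  ... | no x∉D = ⊥-elim (x∉D x∈D)

  shadow-cover : IsVertexCover G shadow
  shadow-cover = vertexCover-from-edges G shadow meets
    where
    meets : ∀ {e} → IsEdge G e → T (shadow (proj₁ e)) ⊎ T (shadow (proj₂ e))
    meets {a , b} ab-edge with edge a b ∈? D
    ... | yes ab∈D = inj₁ (endpoint-shadow ab∈D (inj₁ refl))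
    ... | no ab∉D with covers (edge a b) ab-edge ab∉D
    ...   | vtx _ , u∈D , inj₁ refl = inj₁ (vertex-shadow u∈D (proj₂ ab-edge))
    ...   | vtx _ , u∈D , inj₂ refl = inj₂ (vertex-shadow u∈D (adj-sym G (proj₂ ab-edge)))
    ...   | edge _ _ , cd∈D , inj₁ c∈ab = meets-endpoint shadow c∈ab (endpoint-shadow cd∈D (inj₁ refl))
    ...   | edge _ _ , cd∈D , inj₂ d∈ab = meets-endpoint shadow d∈ab (endpoint-shadow cd∈D (inj₂ refl))

  shadow-nonisolated : ∀ {x} → T (shadow x) → ¬ T (isolated G x)
  shadow-nonisolated {x} sx with ∨-elim (⌊ vtx x ∈? D ⌋ ∧ not (isolated G x)) sx
  ... | inj₁ x∈D = not-elim (∧-elimʳ ⌊ vtx x ∈? D ⌋ x∈D)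
  ... | inj₂ on-edge with find (any⁻ (hasEndpoint x) D on-edge)
  ...   | edge a b , ab∈D , x∈ab = endpoint-nonisolated G (All.lookup valid ab∈D) (endpoint x∈ab)
    where
    endpoint : T (hasEndpoint x (edge a b)) → x ∈ₑ (a , b)
    endpoint t with ∨-elim (x == a) t
    ... | inj₁ x≡a = inj₁ (==-sound x≡a)
    ... | inj₂ x≡b = inj₂ (==-sound x≡b)

  -- An isolated vertex can only be covered by itself.
  isolated-∈ : ∀ {x} → T (isolated G x) → vtx x ∈ D
  isolated-∈ {x} iso with vtx x ∈? D
  ... | yes x∈D = x∈D
  ... | no x∉D with covers (vtx x) tt x∉D
  ...   | y , y∈D , touches = ⊥-elim (isolated-untouched G y iso (All.lookup valid y∈D) touches)

  -- The vertex a slot of D stands for.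
  slotVertex : Elem n × Bool → Fin n
  slotVertex (vtx x , _)        = x
  slotVertex (edge a b , false) = a
  slotVertex (edge a b , true)  = b

  edgeSlot : Fin n → List (Elem n) → Elem n × Bool
  edgeSlot x []               = vtx x , false
  edgeSlot x (vtx _ ∷ ys)     = edgeSlot x ys
  edgeSlot x (edge a b ∷ ys) with x ≟ a | x ≟ b
  ... | yes _ | _     = edge a b , false
  ... | no _  | yes _ = edge a b , true
  ... | no _  | no _  = edgeSlot x ys

  owner : Fin n → Elem n × Bool
  owner x with vtx x ∈? D
  ... | yes _ = vtx x , false
  ... | no _  = edgeSlot x D

  edgeSlot-vertex : ∀ x ys → slotVertex (edgeSlot x ys) ≡ x
  edgeSlot-vertex x []              = refl
  edgeSlot-vertex x (vtx _ ∷ ys)    = edgeSlot-vertex x ys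
  edgeSlot-vertex x (edge a b ∷ ys) with x ≟ a | x ≟ b
  ... | yes x≡a | _       = sym x≡a
  ... | no _    | yes x≡b = sym x≡b
  ... | no _    | no _    = edgeSlot-vertex x ys

  owner-vertex : ∀ x → slotVertex (owner x) ≡ x
  owner-vertex x with vtx x ∈? D
  ... | yes _ = refl
  ... | no _  = edgeSlot-vertex x D

  edgeSlot-∈ : ∀ {x} ys → T (any (hasEndpoint x) ys) → edgeSlot x ys ∈ tagged ys
  edgeSlot-∈ (vtx _ ∷ ys) t = there (there (edgeSlot-∈ ys t))
  edgeSlot-∈ {x} (edge a b ∷ ys) t with x ≟ a | x ≟ b
  ... | yes _ | _     = here refl
  ... | no _  | yes _ = there (here refl)
  ... | no _  | no _  = there (there (edgeSlot-∈ ys t))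

  owner-∈ : ∀ {x} → T (shadow x) → owner x ∈ tagged D
  owner-∈ {x} sx with vtx x ∈? D
  ... | yes x∈D = tagged-∈ false x∈D
  ... | no _    = edgeSlot-∈ D sx

  Source : Set
  Source = Fin n ⊎ (Fin n × Bool)

  Charged : Source → Set
  Charged = [ T ∘ shadow , T ∘ isolated G ∘ proj₁ ]

  slot : Source → Elem n × Bool
  slot (inj₁ x)       = owner x
  slot (inj₂ (y , b)) = vtx y , b

  owned-by : ∀ {x σ} → owner x ≡ σ → x ≡ slotVertex σ
  owned-by {x} refl = sym (owner-vertex x)

  -- Shadow vertices are never isolated, and slots remember their vertex.
  slot-injective : ∀ {p q} → Charged p → Charged q → slot p ≡ slot q → p ≡ q
  slot-injective {inj₁ x} {inj₁ y} _ _ same = cong inj₁ (trans (owned-by same) (owner-vertex y))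
  slot-injective {inj₁ x} {inj₂ _} sx iy same =
    ⊥-elim (shadow-nonisolated sx (subst (T ∘ isolated G) (sym (owned-by same)) iy))
  slot-injective {inj₂ _} {inj₁ x} iy sx same =
    ⊥-elim (shadow-nonisolated sx (subst (T ∘ isolated G) (sym (owned-by (sym same))) iy))
  slot-injective {inj₂ (y , b)} {inj₂ (.y , .b)} _ _ refl = refl

  slot-∈ : ∀ {p} → Charged p → slot p ∈ tagged D
  slot-∈ {inj₁ x}       sx  = owner-∈ sx
  slot-∈ {inj₂ (y , b)} iso = tagged-∈ b (isolated-∈ iso)

  shadow-bound : countV shadow + 2 * isolatedCount G ≤ 2 * length D
  shadow-bound = begin
    countV shadow + 2 * isolatedCount G  ≡⟨ cong (countV shadow +_) (sym (length-tagged isolatedList)) ⟩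
    countV shadow + length (tagged isolatedList)
                                         ≡⟨ sym (length-⊕ (vertices shadow) (tagged isolatedList)) ⟩
    length (vertices shadow ⊕ tagged isolatedList)
      ≤⟨ injection-bound Charged slot
           (⊕-unique (vertices-unique shadow) (tagged-unique (vertices-unique (isolated G))))
           (⊕-all (vertices-sound shadow) (tagged-all (vertices-sound (isolated G))))
           slot-injective (λ {p} → slot-∈ {p}) ⟩
    length (tagged D)                    ≡⟨ length-tagged D ⟩
    2 * length D                         ∎
    where
    open ≤-Reasoning
    isolatedList : List (Fin n)
    isolatedList = vertices (isolated G)

lemma1 : (n : ℕ) (G : Graph n) (M : List (Fin n × Fin n)) →
         IsMaximumMatching G M →
         (D : List (Elem n)) → TotalCover G D →
         length M + kCount G M + 2 * isolatedCount G ≤ 2 * length D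
lemma1 n G M maximum D total = begin
  length M + kCount G M + 2 * isolatedCount G  ≤⟨ +-monoˡ-≤ (2 * isolatedCount G) m+k≤|S| ⟩
  countV shadow + 2 * isolatedCount G          ≤⟨ shadow-bound ⟩
  2 * length D                                 ∎
  where
  open ≤-Reasoning
  open ShadowBound G total using (shadow; shadow-cover; shadow-bound)
  m+k≤|S| : length M + kCount G M ≤ countV shadow
  m+k≤|S| = MatchingBound.matching-bound maximum shadow shadow-cover
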